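{- Let $q$ be a prime power, $u,v$ non-zero elements of $\mathbb{F}_q$, and write $\mathrm{Rad}(q-1)=k\,p_1\cdots p_s$ with $k$ a divisor and $p_1,\dots,p_s$ distinct primes. Let $N_{k,q-1}=N(k,k,k,q-1)$. Then $$N_{q-1}\ge\sum_{i=1}^s\{N(p_ik,k,k,q-1)+N(k,p_ik,k,q-1)+N(k,k,p_ik,q-1)\}-(3s-1)N_{k,q-1}.$$ Hence, with $\delta_3=1-3\sum_{i=1}^s\frac1{p_i}$, $$N_{q-1}\ge\sum_{i=1}^s\Big\{[N(p_ik,k,k,q-1)-\theta(p_i)N_{k,q-1}]+[N(k,p_ik,k,q-1)-\theta(p_i)N_{k,q-1}]+[N(k,k,p_ik,q-1)-\theta(p_i)N_{k,q-1}]\Big\}+\delta_3N_{k,q-1}.$$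
   Context: For $e\mid q-1$, a non-zero $a\in\mathbb{F}_q$ is $e$-free if $a=b^d$ with $b\in\mathbb{F}_q$ and $d\mid e$ implies $d=1$. For divisors $e_1,\dots,e_4$ of $q-1$, $N(e_1,e_2,e_3,e_4)$ is the number of pairs $(a,b)$ of non-zero elements of $\mathbb{F}_q$ such that $a$, $b$, $ua+vb$, $va^{ -1}+ub^{ -1}$ are respectively $e_1$-, $e_2$-, $e_3$-, $e_4$-free; $N_e=N(e,e,e,e)$. $\mathrm{Rad}(m)$ is the product of the distinct primes dividing $m$; $\theta(m)=\phi(m)/m$. -}

module Defs where

open import Level using (0ℓ)
open import Data.Nat as ℕ using (ℕ; zero; suc; _∸_; NonZero; _≤_; _<_; s≤s)
open import Data.Nat.Properties as ℕP using ()
open import Data.Nat.Divisibility using (_∣_; _∣?_; ∣⇒≤)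
open import Data.Nat.Primality using (Prime; prime?; productOfPrimes≢0)
open import Data.Nat.Coprimality using (Coprime; coprime?)
open import Data.Fin as Fin using (Fin; toℕ; fromℕ<)
open import Data.Fin.Properties using (all?; toℕ-fromℕ<) renaming (_≟_ to _≟ᶠ_)
open import Data.List using (List; upTo; filter; map; allFin; length)
open import Data.Nat.ListAction using (sum; product)
open import Data.List.Relation.Unary.All as All using (All)
open import Data.List.Relation.Unary.All.Properties using (all-filter)
open import Data.Integer as ℤ using (ℤ)
open import Data.Rational as ℚ using (ℚ)
import Data.Empty
import Data.Product
open import Data.Product using (_×_; _,_; proj₁; proj₂)
open import Data.Bool using (if_then_else_)
open import Algebra.Core using (Op₁; Op₂)
open import Algebra.Structures using (IsCommutativeRing)
open import Function.Bundles using (_↔_; Inverse)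
open import Relation.Nullary using (Dec; yes; no; ¬_; does)
open import Relation.Nullary.Decidable using (_×-dec_; _→-dec_; map′; ¬?)
open import Relation.Binary.Definitions using (DecidableEquality)
open import Relation.Binary.PropositionalEquality using (_≡_; _≢_; refl; sym; trans; cong; subst)

Rad : ℕ → ℕ
Rad m = product (filter (λ p → prime? p ×-dec p ∣? m) (upTo (suc m)))

φ : ℕ → ℕ
φ m = length (filter (λ i → coprime? i m) (Data.List.map suc (upTo m)))

θ : (m : ℕ) → .{{NonZero m}} → ℚ
θ m = ℤ.+ (φ m) ℚ./ m

∑ℤ : (s : ℕ) → (Fin s → ℤ) → ℤ
∑ℤ zero    f = ℤ.+ 0
∑ℤ (suc s) f = f Fin.zero ℤ.+ ∑ℤ s (λ i → f (Fin.suc i))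

∑ℚ : (s : ℕ) → (Fin s → ℚ) → ℚ
∑ℚ zero    f = ℚ.0ℚ
∑ℚ (suc s) f = f Fin.zero ℚ.+ ∑ℚ s (λ i → f (Fin.suc i))

∏ℕ : (s : ℕ) → (Fin s → ℕ) → ℕ
∏ℕ zero    f = 1
∏ℕ (suc s) f = f Fin.zero ℕ.* ∏ℕ s (λ i → f (Fin.suc i))

IsPrimePower : ℕ → Set
IsPrimePower q = Data.Product.∃ λ p → Data.Product.∃ λ n → Prime p × 1 ≤ n × q ≡ p ℕ.^ n

record FiniteField (q : ℕ) : Set₁ where
  infixl 7 _*_
  infixl 6 _+_
  infix  8 _⁻¹
  field
    Carrier           : Set
    _+_ _*_           : Op₂ Carrier
    -_                : Op₁ Carrier
    0# 1#             : Carrier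
    isCommutativeRing : IsCommutativeRing _≡_ _+_ _*_ -_ 0# 1#
    _⁻¹               : Carrier → Carrier
    0≢1               : 0# ≢ 1#
    ⁻¹-inverse        : ∀ x → x ≢ 0# → x * x ⁻¹ ≡ 1#
    enum              : Fin q ↔ Carrier

  open Inverse enum using (to; from; strictlyInverseˡ; strictlyInverseʳ)

  _^_ : Carrier → ℕ → Carrier
  x ^ zero  = 1#
  x ^ suc n = x * (x ^ n)

  _≟_ : DecidableEquality Carrier
  x ≟ y with from x ≟ᶠ from y
  ... | yes eq = yes (trans (sym (strictlyInverseˡ x)) (trans (cong to eq) (strictlyInverseˡ y)))
  ... | no ne  = no (λ eq → ne (cong from eq))

  Free : ℕ → Carrier → Set
  Free e a = a ≢ 0# × (∀ d → d ∣ e → ∀ b → a ≡ b ^ d → d ≡ 1)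

  private
    Bounded : ℕ → Carrier → Set
    Bounded e a = ∀ (i : Fin (suc e)) → toℕ i ∣ e → ∀ (j : Fin q) → a ≡ to j ^ toℕ i → toℕ i ≡ 1

    bounded? : ∀ e a → Dec (Bounded e a)
    bounded? e a = all? λ i → (toℕ i ∣? e) →-dec all? λ j → (a ≟ (to j ^ toℕ i)) →-dec (toℕ i ℕP.≟ 1)

  -- decidability of e-freeness (for e ≠ 0; in the paper e ∣ q - 1 so e ≠ 0)
  free? : (e : ℕ) → .{{NonZero e}} → (a : Carrier) → Dec (Free e a)
  free? e a = (¬? (a ≟ 0#)) ×-dec map′ back forth (bounded? e a)
    where
    forth : (∀ d → d ∣ e → ∀ b → a ≡ b ^ d → d ≡ 1) → Bounded e a
    forth h i i∣e j eq = h (toℕ i) i∣e (to j) eq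
    back : Bounded e a → ∀ d → d ∣ e → ∀ b → a ≡ b ^ d → d ≡ 1
    back h d d∣e b eq =
      let d<e+1 = s≤s (∣⇒≤ d∣e)
          i     = fromℕ< d<e+1
          p     = toℕ-fromℕ< d<e+1
          r     = h i (subst (_∣ e) (sym p) d∣e) (from b)
                    (subst (λ c → a ≡ to (from b) ^ c) (sym p)
                      (subst (λ c → a ≡ c ^ d) (sym (strictlyInverseˡ b)) eq))
      in trans (sym p) r

  countPairs : (P : Carrier → Carrier → Set) → (∀ a b → Dec (P a b)) → ℕ
  countPairs P P? =
    sum (map (λ i → sum (map (λ j → if does (P? (to i) (to j)) then 1 else 0) (allFin q))) (allFin q))

  Cond : Carrier → Carrier → ℕ → ℕ → ℕ → ℕ → Carrier → Carrier → Set
  Cond u v e₁ e₂ e₃ e₄ a b =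
    a ≢ 0# × b ≢ 0# × Free e₁ a × Free e₂ b × Free e₃ (u * a + v * b) × Free e₄ (v * a ⁻¹ + u * b ⁻¹)

  N : (u v : Carrier) (e₁ e₂ e₃ e₄ : ℕ) →
      .{{NonZero e₁}} → .{{NonZero e₂}} → .{{NonZero e₃}} → .{{NonZero e₄}} → ℕ
  N u v e₁ e₂ e₃ e₄ = countPairs (Cond u v e₁ e₂ e₃ e₄) λ a b →
    ¬? (a ≟ 0#) ×-dec ¬? (b ≟ 0#) ×-dec free? e₁ a ×-dec free? e₂ b ×-dec
    free? e₃ (u * a + v * b) ×-dec free? e₄ (v * a ⁻¹ + u * b ⁻¹)

q-1≢0 : ∀ {q} → FiniteField q → NonZero (q ∸ 1)
q-1≢0 {zero} F = Data.Empty.⊥-elim-irr (absurd (Inverse.from (FiniteField.enum F) (FiniteField.0# F)))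
  where absurd : Fin 0 → Data.Empty.⊥
        absurd ()
q-1≢0 {suc zero} F = Data.Empty.⊥-elim (FiniteField.0≢1 F eq)
  where
  open FiniteField F
  open Inverse enum
  one : ∀ (x y : Fin 1) → x ≡ y
  one Fin.zero Fin.zero = refl
  eq : 0# ≡ 1#
  eq = trans (sym (strictlyInverseˡ 0#)) (trans (cong to (one (from 0#) (from 1#))) (strictlyInverseˡ 1#))
q-1≢0 {suc (suc q)} F = _

Rad≢0 : ∀ m → NonZero (Rad m)
Rad≢0 m = productOfPrimes≢0 (All.map proj₁ (all-filter (λ p → prime? p ×-dec p ∣? m) (upTo (suc m))))

k≢0 : ∀ {m k P} → Rad m ≡ k ℕ.* P → NonZero k
k≢0 {m} {k} {P} eq = ℕP.m*n≢0⇒m≢0 k {P} {{subst NonZero eq (Rad≢0 m)}}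

{-# OPTIONS --safe #-}
-- A non-zero a is m-free exactly when it is not an l-th power for any prime l ∣ m, and the primes
-- dividing m are those dividing Rad m = k p₁⋯pₛ.  Hence a pair (a, b) satisfying all 3s conditions
-- counted by N(pᵢk,k,k,q-1), N(k,pᵢk,k,q-1), N(k,k,pᵢk,q-1) is counted by N_{q-1}, while each of
-- these conditions implies the one counted by N_{k,q-1}.  Therefore, for each pair,
--   (number of the 3s conditions it satisfies) − (3s − 1)·[it is counted by N_{k,q-1}]
-- is at most [it is counted by N_{q-1}]: it is 0 outside N_{k,q-1}, 1 when all 3s conditions
-- hold, and at most 0 otherwise.  Summing over all pairs gives the first inequality; the second
-- is the same inequality rewritten with θ(pᵢ) = 1 − 1/pᵢ.
module Submission where

open import Defs
open import Algebra.Bundles using (CommutativeMonoid)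
open import Algebra.Structures using (IsCommutativeRing)
open import Data.Bool using (if_then_else_)
open import Data.Empty using (⊥-elim)
open import Data.Fin using (Fin)
open import Data.Fin.Properties using (all?; ¬∀⟶∃¬)
open import Data.Integer as ℤ using (ℤ; +_; +≤+; +<+)
import Data.Integer.Properties as ℤP
open import Data.Integer.Tactic.RingSolver using (solve-∀)
open import Data.List using (List; []; _∷_; _++_; map; allFin; filter; upTo; length)
open import Data.List.Membership.Propositional.Properties using (∈-filter⁺; ∈-upTo⁺)
open import Data.List.Properties
  using (upTo-∷ʳ; map-++; filter-++; filter-all; filter-reject; ++-identityʳ; length-map; length-upTo)
open import Data.List.Relation.Unary.All using (All; _∷_)
open import Data.List.Relation.Unary.All.Properties using (map⁺; applyUpTo⁺₁)
open import Data.Nat as ℕ using (ℕ; zero; suc; _∸_; NonZero; z≤n; s≤s)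
open import Data.Nat.Coprimality as C using (Coprime; coprime?; prime⇒coprime)
open import Data.Nat.Divisibility
  using (_∣_; _∣?_; divides; ∣-refl; ∣-trans; m∣m*n; n∣m*n; ∣1⇒≡1; 0∣⇒≡0; ∣⇒≤)
open import Data.Nat.ListAction using (sum; product)
open import Data.Nat.ListAction.Properties using (∈⇒∣product)
open import Data.Nat.Primality using (Prime; prime?; prime⇒nonZero; prime⇒nonTrivial; euclidsLemma)
open import Data.Nat.Primality.Factorisation using (factorise)
open import Data.Nat.Properties as ℕP using (m*n≢0)
open import Data.Nat.Tactic.RingSolver using () renaming (solve-∀ to ℕ-solve-∀)
open import Data.Product using (_×_; _,_; proj₁; proj₂; ∃-syntax)
open import Data.Rational as ℚ using (ℚ; toℚᵘ)
open import Data.Rational.Properties as ℚP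
  using (toℚᵘ-fromℚᵘ; toℚᵘ-injective; toℚᵘ-homo-+; toℚᵘ-homo-*; toℚᵘ-homo‿-; toℚᵘ-cancel-≤)
open import Data.Rational.Solver using (module +-*-Solver)
open import Data.Rational.Unnormalised as ℚᵘ using (mkℚᵘ; *≡*; *≤*)
import Data.Rational.Unnormalised.Properties as ℚᵘP
open import Data.Sum using (_⊎_; inj₁; inj₂; [_,_])
open import Function using (_∘_)
open import Function.Bundles using (Inverse)
open import Relation.Nullary using (Dec; yes; no; does; ¬_)
open import Relation.Nullary.Decidable using (_×-dec_; ¬?)
open import Relation.Binary.PropositionalEquality
  using (_≡_; _≢_; refl; sym; trans; cong; cong₂; subst; module ≡-Reasoning)

prime≢1 : ∀ {l} → Prime l → l ≢ 1
prime≢1 pl = ℕ.nonTrivial⇒≢1 {{prime⇒nonTrivial pl}}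

prime-factor : ∀ n → ∃[ l ] Prime l × l ∣ 2 ℕ.+ n
prime-factor n with factorise (2 ℕ.+ n)
... | record { factors = [] ; isFactorisation = () }
... | record { factors = l ∷ ls ; isFactorisation = eq ; factorsPrime = pl ∷ _ } =
  l , pl , subst (l ∣_) (sym eq) (m∣m*n (product ls))

prime∣Rad : ∀ {l m} → .{{NonZero m}} → Prime l → l ∣ m → l ∣ Rad m
prime∣Rad {l} {m} pl l∣m =
  ∈⇒∣product (∈-filter⁺ (λ p → prime? p ×-dec p ∣? m) (∈-upTo⁺ (s≤s (∣⇒≤ l∣m))) (pl , l∣m))

prime∣∏ℕ : ∀ {l} → Prime l → ∀ s (p : Fin s → ℕ) → l ∣ ∏ℕ s p → ∃[ i ] l ∣ p i
prime∣∏ℕ pl zero    p l∣1 = ⊥-elim (prime≢1 pl (∣1⇒≡1 l∣1))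
prime∣∏ℕ pl (suc s) p l∣∏ with euclidsLemma (p Fin.zero) (∏ℕ s (λ i → p (Fin.suc i))) pl l∣∏
... | inj₁ l∣p₀ = Fin.zero , l∣p₀
... | inj₂ l∣∏′ with prime∣∏ℕ pl s (λ i → p (Fin.suc i)) l∣∏′
... | i , l∣pᵢ = Fin.suc i , l∣pᵢ

∑ℤ-cong : ∀ s {f g : Fin s → ℤ} → (∀ i → f i ≡ g i) → ∑ℤ s f ≡ ∑ℤ s g
∑ℤ-cong zero    f≗g = refl
∑ℤ-cong (suc s) f≗g = cong₂ ℤ._+_ (f≗g Fin.zero) (∑ℤ-cong s (λ i → f≗g (Fin.suc i)))

∑ℤ-+ : ∀ s (f g : Fin s → ℤ) → ∑ℤ s (λ i → f i ℤ.+ g i) ≡ ∑ℤ s f ℤ.+ ∑ℤ s g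
∑ℤ-+ zero    f g = refl
∑ℤ-+ (suc s) f g = trans (cong (λ x → (f Fin.zero ℤ.+ g Fin.zero) ℤ.+ x) (∑ℤ-+ s _ _))
  (+-interchange (f Fin.zero) (g Fin.zero) _ _)
  where open import Algebra.Properties.CommutativeSemigroup ℤP.+-commutativeSemigroup
          using () renaming (interchange to +-interchange)

∑ℤ-const : ∀ s n → ∑ℤ s (λ _ → + n) ≡ + (s ℕ.* n)
∑ℤ-const zero    n = refl
∑ℤ-const (suc s) n = cong (λ x → + n ℤ.+ x) (∑ℤ-const s n)

∑ℤ-mono-≤ : ∀ s {f g : Fin s → ℤ} → (∀ i → f i ℤ.≤ g i) → ∑ℤ s f ℤ.≤ ∑ℤ s g
∑ℤ-mono-≤ zero    f≤g = ℤP.≤-refl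
∑ℤ-mono-≤ (suc s) f≤g = ℤP.+-mono-≤ (f≤g Fin.zero) (∑ℤ-mono-≤ s (λ i → f≤g (Fin.suc i)))

∑ℤ-mono-< : ∀ s {f g : Fin s → ℤ} → (∀ i → f i ℤ.≤ g i) → ∀ i → f i ℤ.< g i → ∑ℤ s f ℤ.< ∑ℤ s g
∑ℤ-mono-< (suc s) f≤g Fin.zero    f<g = ℤP.+-mono-<-≤ f<g (∑ℤ-mono-≤ s (λ i → f≤g (Fin.suc i)))
∑ℤ-mono-< (suc s) f≤g (Fin.suc i) f<g = ℤP.+-mono-≤-< (f≤g Fin.zero) (∑ℤ-mono-< s (λ j → f≤g (Fin.suc j)) i f<g)

sieve : (s a : ℕ) (b₁ b₂ b₃ : Fin s → ℕ) → ℤ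
sieve s a b₁ b₂ b₃ = ∑ℤ s (λ i → + b₁ i ℤ.+ + b₂ i ℤ.+ + b₃ i) ℤ.- (+ (3 ℕ.* s) ℤ.- + 1) ℤ.* + a

sieve-zero : ∀ s → sieve s 0 (λ _ → 0) (λ _ → 0) (λ _ → 0) ≡ + 0
sieve-zero s = begin
  ∑ℤ s (λ _ → + 0) ℤ.- c ℤ.* + 0  ≡⟨ cong₂ ℤ._-_ (∑ℤ-const s 0) (ℤP.*-zeroʳ c) ⟩
  + (s ℕ.* 0) ℤ.- + 0              ≡⟨ cong +_ (trans (ℕP.+-identityʳ _) (ℕP.*-zeroʳ s)) ⟩
  + 0                              ∎
  where
  open ≡-Reasoning
  c = + (3 ℕ.* s) ℤ.- + 1

sieve-+ : ∀ s a a′ (b₁ b₂ b₃ b₁′ b₂′ b₃′ : Fin s → ℕ) →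
  sieve s (a ℕ.+ a′) (λ i → b₁ i ℕ.+ b₁′ i) (λ i → b₂ i ℕ.+ b₂′ i) (λ i → b₃ i ℕ.+ b₃′ i)
    ≡ sieve s a b₁ b₂ b₃ ℤ.+ sieve s a′ b₁′ b₂′ b₃′
sieve-+ s a a′ b₁ b₂ b₃ b₁′ b₂′ b₃′ = begin
  ∑ℤ s (λ i → + (b₁ i ℕ.+ b₁′ i) ℤ.+ + (b₂ i ℕ.+ b₂′ i) ℤ.+ + (b₃ i ℕ.+ b₃′ i)) ℤ.- c ℤ.* + (a ℕ.+ a′)
    ≡⟨ cong₂ (λ x y → x ℤ.- c ℤ.* y) (trans (∑ℤ-cong s regroup) (∑ℤ-+ s t t′)) (ℤP.pos-+ a a′) ⟩
  (∑ℤ s t ℤ.+ ∑ℤ s t′) ℤ.- c ℤ.* (+ a ℤ.+ + a′)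
    ≡⟨ distribute (∑ℤ s t) (∑ℤ s t′) c (+ a) (+ a′) ⟩
  (∑ℤ s t ℤ.- c ℤ.* + a) ℤ.+ (∑ℤ s t′ ℤ.- c ℤ.* + a′) ∎
  where
  open ≡-Reasoning
  c = + (3 ℕ.* s) ℤ.- + 1
  t t′ : Fin s → ℤ
  t  i = + b₁ i ℤ.+ + b₂ i ℤ.+ + b₃ i
  t′ i = + b₁′ i ℤ.+ + b₂′ i ℤ.+ + b₃′ i
  regroup : ∀ i → + (b₁ i ℕ.+ b₁′ i) ℤ.+ + (b₂ i ℕ.+ b₂′ i) ℤ.+ + (b₃ i ℕ.+ b₃′ i) ≡ t i ℤ.+ t′ i
  regroup i = cong +_ (ℕ-regroup (b₁ i) (b₂ i) (b₃ i) (b₁′ i) (b₂′ i) (b₃′ i))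
    where
    ℕ-regroup : ∀ x y z x′ y′ z′ → (x ℕ.+ x′) ℕ.+ (y ℕ.+ y′) ℕ.+ (z ℕ.+ z′) ≡ (x ℕ.+ y ℕ.+ z) ℕ.+ (x′ ℕ.+ y′ ℕ.+ z′)
    ℕ-regroup = ℕ-solve-∀
  distribute : ∀ x y z w w′ → (x ℤ.+ y) ℤ.- z ℤ.* (w ℤ.+ w′) ≡ (x ℤ.- z ℤ.* w) ℤ.+ (y ℤ.- z ℤ.* w′)
  distribute = solve-∀

sieve-sum : ∀ s {X : Set} (L : List X) {a Q : X → ℕ} {b₁ b₂ b₃ : Fin s → X → ℕ} →
  (∀ x → sieve s (a x) (λ i → b₁ i x) (λ i → b₂ i x) (λ i → b₃ i x) ℤ.≤ + Q x) →
  sieve s (sum (map a L)) (λ i → sum (map (b₁ i) L)) (λ i → sum (map (b₂ i) L)) (λ i → sum (map (b₃ i) L))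
    ℤ.≤ + sum (map Q L)
sieve-sum s []      _     = ℤP.≤-reflexive (sieve-zero s)
sieve-sum s {X} (x ∷ L) {a} {Q} {b₁} {b₂} {b₃} sieve≤Q = begin
  sieve s (a x ℕ.+ Σ a) (λ i → b₁ i x ℕ.+ Σ (b₁ i)) (λ i → b₂ i x ℕ.+ Σ (b₂ i)) (λ i → b₃ i x ℕ.+ Σ (b₃ i))
    ≡⟨ sieve-+ s (a x) (Σ a) (λ i → b₁ i x) (λ i → b₂ i x) (λ i → b₃ i x)
                 (λ i → Σ (b₁ i)) (λ i → Σ (b₂ i)) (λ i → Σ (b₃ i)) ⟩
  sieve s (a x) (λ i → b₁ i x) (λ i → b₂ i x) (λ i → b₃ i x)
    ℤ.+ sieve s (Σ a) (λ i → Σ (b₁ i)) (λ i → Σ (b₂ i)) (λ i → Σ (b₃ i))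
    ≤⟨ ℤP.+-mono-≤ (sieve≤Q x) (sieve-sum s L sieve≤Q) ⟩
  + Q x ℤ.+ + Σ Q
    ≡⟨ ℤP.pos-+ (Q x) (Σ Q) ⟨
  + (Q x ℕ.+ Σ Q) ∎
  where
  open ℤP.≤-Reasoning
  Σ : (X → ℕ) → ℕ
  Σ f = sum (map f L)

𝟙 : ∀ {P : Set} → Dec P → ℕ
𝟙 d = if does d then 1 else 0

𝟙-yes : ∀ {P : Set} (d : Dec P) → P → 𝟙 d ≡ 1
𝟙-yes (yes _) _ = refl
𝟙-yes (no ¬p) p = ⊥-elim (¬p p)

𝟙-no : ∀ {P : Set} (d : Dec P) → ¬ P → 𝟙 d ≡ 0
𝟙-no (yes p) ¬p = ⊥-elim (¬p p)
𝟙-no (no _)  _  = refl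

𝟙≤1 : ∀ {P : Set} (d : Dec P) → 𝟙 d ℕ.≤ 1
𝟙≤1 (yes _) = ℕP.≤-refl
𝟙≤1 (no _)  = z≤n

𝟙-sum≤3 : ∀ {P₁ P₂ P₃ : Set} (d₁ : Dec P₁) (d₂ : Dec P₂) (d₃ : Dec P₃) → 𝟙 d₁ ℕ.+ 𝟙 d₂ ℕ.+ 𝟙 d₃ ℕ.≤ 3
𝟙-sum≤3 d₁ d₂ d₃ = ℕP.+-mono-≤ (ℕP.+-mono-≤ (𝟙≤1 d₁) (𝟙≤1 d₂)) (𝟙≤1 d₃)

𝟙-sum<3 : ∀ {P₁ P₂ P₃ : Set} (d₁ : Dec P₁) (d₂ : Dec P₂) (d₃ : Dec P₃) →
  ¬ (P₁ × P₂ × P₃) → 𝟙 d₁ ℕ.+ 𝟙 d₂ ℕ.+ 𝟙 d₃ ℕ.< 3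
𝟙-sum<3 (yes p₁) (yes p₂) (yes p₃) ¬all = ⊥-elim (¬all (p₁ , p₂ , p₃))
𝟙-sum<3 (no _)   d₂       d₃       _    = s≤s (ℕP.+-mono-≤ (𝟙≤1 d₂) (𝟙≤1 d₃))
𝟙-sum<3 (yes _)  (no _)   d₃       _    = s≤s (s≤s (𝟙≤1 d₃))
𝟙-sum<3 (yes _)  (yes _)  (no _)   _    = ℕP.≤-refl

sieve-indicator : ∀ s {Q A : Set} {B₁ B₂ B₃ : Fin s → Set} (Q? : Dec Q) (A? : Dec A)
  (B₁? : ∀ i → Dec (B₁ i)) (B₂? : ∀ i → Dec (B₂ i)) (B₃? : ∀ i → Dec (B₃ i)) →
  (∀ i → B₁ i ⊎ B₂ i ⊎ B₃ i → A) → (A → (∀ i → B₁ i × B₂ i × B₃ i) → Q) →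
  sieve s (𝟙 A?) (λ i → 𝟙 (B₁? i)) (λ i → 𝟙 (B₂? i)) (λ i → 𝟙 (B₃? i)) ℤ.≤ + 𝟙 Q?
sieve-indicator s {Q} {A} {B₁} {B₂} {B₃} Q? A? B₁? B₂? B₃? B⇒A all⇒Q =
  bound A? (all? (λ i → B₁? i ×-dec B₂? i ×-dec B₃? i))
  where
  open ℤP.≤-Reasoning
  c = + (3 ℕ.* s) ℤ.- + 1
  t : Fin s → ℤ
  t i = + 𝟙 (B₁? i) ℤ.+ + 𝟙 (B₂? i) ℤ.+ + 𝟙 (B₃? i)

  t≡0 : ¬ A → ∀ i → t i ≡ + 0
  t≡0 ¬a i rewrite 𝟙-no (B₁? i) (¬a ∘ B⇒A i ∘ inj₁)
                 | 𝟙-no (B₂? i) (¬a ∘ B⇒A i ∘ inj₂ ∘ inj₁)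
                 | 𝟙-no (B₃? i) (¬a ∘ B⇒A i ∘ inj₂ ∘ inj₂) = refl

  t≡3 : (∀ i → B₁ i × B₂ i × B₃ i) → ∀ i → t i ≡ + 3
  t≡3 all i with all i
  ... | b₁ , b₂ , b₃ rewrite 𝟙-yes (B₁? i) b₁ | 𝟙-yes (B₂? i) b₂ | 𝟙-yes (B₃? i) b₃ = refl

  ∑t<3s : ∀ i₀ → ¬ (B₁ i₀ × B₂ i₀ × B₃ i₀) → ∑ℤ s t ℤ.< + (3 ℕ.* s)
  ∑t<3s i₀ ¬all₀ = subst (∑ℤ s t ℤ.<_) (trans (∑ℤ-const s 3) (cong +_ (ℕP.*-comm s 3)))
    (∑ℤ-mono-< s (λ i → +≤+ (𝟙-sum≤3 (B₁? i) (B₂? i) (B₃? i)))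
               i₀ (+<+ (𝟙-sum<3 (B₁? i₀) (B₂? i₀) (B₃? i₀) ¬all₀)))

  bound : (A?′ : Dec A) → Dec (∀ i → B₁ i × B₂ i × B₃ i) → ∑ℤ s t ℤ.- c ℤ.* + 𝟙 A?′ ℤ.≤ + 𝟙 Q?
  bound (no ¬a) _ = begin
    ∑ℤ s t ℤ.- c ℤ.* + 0             ≡⟨ cong (λ x → ∑ℤ s t ℤ.- x) (ℤP.*-zeroʳ c) ⟩
    ∑ℤ s t ℤ.+ + 0                   ≡⟨ ℤP.+-identityʳ _ ⟩
    ∑ℤ s t                           ≡⟨ ∑ℤ-cong s (t≡0 ¬a) ⟩
    ∑ℤ s (λ _ → + 0)                 ≡⟨ trans (∑ℤ-const s 0) (cong +_ (ℕP.*-zeroʳ s)) ⟩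
    + 0                              ≤⟨ +≤+ z≤n ⟩
    + 𝟙 Q?                           ∎
  bound (yes a) (yes all) = begin
    ∑ℤ s t ℤ.- c ℤ.* + 1             ≡⟨ cong (λ x → x ℤ.- c ℤ.* + 1) (∑ℤ-cong s (t≡3 all)) ⟩
    ∑ℤ s (λ _ → + 3) ℤ.- c ℤ.* + 1   ≡⟨ cong (λ x → x ℤ.- c ℤ.* + 1) (trans (∑ℤ-const s 3) (cong +_ (ℕP.*-comm s 3))) ⟩
    + (3 ℕ.* s) ℤ.- c ℤ.* + 1        ≡⟨ cancel (+ (3 ℕ.* s)) ⟩
    + 1                              ≡⟨ cong +_ (𝟙-yes Q? (all⇒Q a all)) ⟨
    + 𝟙 Q?                           ∎
    where
    cancel : ∀ x → x ℤ.- (x ℤ.- + 1) ℤ.* + 1 ≡ + 1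
    cancel = solve-∀
  bound (yes _) (no ¬all) with ¬∀⟶∃¬ s _ (λ i → B₁? i ×-dec B₂? i ×-dec B₃? i) ¬all
  ... | i₀ , ¬all₀ = begin
    ∑ℤ s t ℤ.- c ℤ.* + 1             ≡⟨ cong (λ x → ∑ℤ s t ℤ.- x) (ℤP.*-identityʳ c) ⟩
    ∑ℤ s t ℤ.- c                     ≤⟨ ℤP.i≤j⇒i-j≤0 ∑t≤c ⟩
    + 0                              ≤⟨ +≤+ z≤n ⟩
    + 𝟙 Q?                           ∎
    where
    ∑t≤c : ∑ℤ s t ℤ.≤ c
    ∑t≤c = subst (∑ℤ s t ℤ.≤_) (ℤP.+-comm ℤ.-1ℤ (+ (3 ℕ.* s))) (ℤP.i<j⇒i≤pred[j] (∑t<3s i₀ ¬all₀))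

module _ {q : ℕ} (F : FiniteField q) where
  open FiniteField F
  open IsCommutativeRing isCommutativeRing using (*-assoc; *-identityˡ)

  ^-+ : ∀ x m n → x ^ (m ℕ.+ n) ≡ x ^ m * x ^ n
  ^-+ x zero    n = sym (*-identityˡ _)
  ^-+ x (suc m) n = trans (cong (x *_) (^-+ x m n)) (sym (*-assoc x _ _))

  ^-* : ∀ x m n → x ^ (m ℕ.* n) ≡ (x ^ m) ^ n
  ^-* x m zero    = cong (x ^_) (ℕP.*-zeroʳ m)
  ^-* x m (suc n) = begin
    x ^ (m ℕ.* suc n)         ≡⟨ cong (x ^_) (ℕP.*-suc m n) ⟩
    x ^ (m ℕ.+ m ℕ.* n)       ≡⟨ ^-+ x m (m ℕ.* n) ⟩
    x ^ m * x ^ (m ℕ.* n)     ≡⟨ cong (x ^ m *_) (^-* x m n) ⟩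
    x ^ m * (x ^ m) ^ n       ∎
    where open ≡-Reasoning

  free∧∣⇒free : ∀ {d e a} → d ∣ e → Free e a → Free d a
  free∧∣⇒free d∣e (a≢0 , free) = a≢0 , λ c c∣d → free c (∣-trans c∣d d∣e)

  prime-free⇒free : ∀ {m a} → .{{NonZero m}} → a ≢ 0# → (∀ {l} → Prime l → l ∣ m → Free l a) → Free m a
  prime-free⇒free {m} {a} a≢0 free = a≢0 , power⇒1
    where
    power⇒1 : ∀ d → d ∣ m → ∀ b → a ≡ b ^ d → d ≡ 1
    power⇒1 zero          0∣m = ⊥-elim (ℕ.≢-nonZero⁻¹ m (0∣⇒≡0 0∣m))
    power⇒1 (suc zero)    _   _ _ = refl
    power⇒1 (suc (suc n)) d∣m b a≡bᵈ with prime-factor n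
    ... | l , pl , l∣d@(divides c d≡cl) =
      ⊥-elim (prime≢1 pl (proj₂ (free pl (∣-trans l∣d d∣m)) l ∣-refl (b ^ c)
        (trans a≡bᵈ (trans (cong (b ^_) d≡cl) (^-* b c l)))))

  free[k]∧free[pk]⇒free[m] : ∀ {m k s} (p : Fin s → ℕ) → .{{NonZero m}} → Rad m ≡ k ℕ.* ∏ℕ s p →
    ∀ {a} → Free k a → (∀ i → Free (p i ℕ.* k) a) → Free m a
  free[k]∧free[pk]⇒free[m] {m} {k} {s} p rad {a} free[k] free[pk] = prime-free⇒free (proj₁ free[k]) free[l]
    where
    free[l] : ∀ {l} → Prime l → l ∣ m → Free l a
    free[l] {l} pl l∣m with euclidsLemma k (∏ℕ s p) pl (subst (l ∣_) rad (prime∣Rad pl l∣m))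
    ... | inj₁ l∣k = free∧∣⇒free l∣k free[k]
    ... | inj₂ l∣∏ with prime∣∏ℕ pl s p l∣∏
    ... | i , l∣pᵢ = free∧∣⇒free (∣-trans l∣pᵢ (m∣m*n k)) (free[pk] i)

  cond-∣ : ∀ {u v e₁ e₂ e₃ e₄ e₁′ e₂′ e₃′ e₄′ a b} → e₁ ∣ e₁′ → e₂ ∣ e₂′ → e₃ ∣ e₃′ → e₄ ∣ e₄′ →
    Cond u v e₁′ e₂′ e₃′ e₄′ a b → Cond u v e₁ e₂ e₃ e₄ a b
  cond-∣ d₁ d₂ d₃ d₄ (a≢0 , b≢0 , f₁ , f₂ , f₃ , f₄) =
    a≢0 , b≢0 , free∧∣⇒free d₁ f₁ , free∧∣⇒free d₂ f₂ , free∧∣⇒free d₃ f₃ , free∧∣⇒free d₄ f₄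

  cond[k]∧cond[pk]⇒cond[m] : ∀ {u v m k s e a b} (p : Fin s → ℕ) → .{{NonZero m}} → Rad m ≡ k ℕ.* ∏ℕ s p →
    Cond u v k k k e a b →
    (∀ i → Cond u v (p i ℕ.* k) k k e a b × Cond u v k (p i ℕ.* k) k e a b × Cond u v k k (p i ℕ.* k) e a b) →
    Cond u v m m m e a b
  cond[k]∧cond[pk]⇒cond[m] p rad (a≢0 , b≢0 , f₁ , f₂ , f₃ , f₄) conds =
    a≢0 , b≢0 ,
    free[k]∧free[pk]⇒free[m] p rad f₁ (λ i → free₁ (proj₁ (conds i))) ,
    free[k]∧free[pk]⇒free[m] p rad f₂ (λ i → free₂ (proj₁ (proj₂ (conds i)))) ,
    free[k]∧free[pk]⇒free[m] p rad f₃ (λ i → free₃ (proj₂ (proj₂ (conds i)))) , f₄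
    where
    free₁ : ∀ {u v e₁ e₂ e₃ e₄ a b} → Cond u v e₁ e₂ e₃ e₄ a b → Free e₁ a
    free₁ (_ , _ , f , _) = f
    free₂ : ∀ {u v e₁ e₂ e₃ e₄ a b} → Cond u v e₁ e₂ e₃ e₄ a b → Free e₂ b
    free₂ (_ , _ , _ , f , _) = f
    free₃ : ∀ {u v e₁ e₂ e₃ e₄ a b} → Cond u v e₁ e₂ e₃ e₄ a b → Free e₃ (u * a + v * b)
    free₃ (_ , _ , _ , _ , f , _) = f

  sieve-countPairs : ∀ s {Q A : Carrier → Carrier → Set} {B₁ B₂ B₃ : Fin s → Carrier → Carrier → Set}
    (Q? : ∀ a b → Dec (Q a b)) (A? : ∀ a b → Dec (A a b))
    (B₁? : ∀ i a b → Dec (B₁ i a b)) (B₂? : ∀ i a b → Dec (B₂ i a b)) (B₃? : ∀ i a b → Dec (B₃ i a b)) →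
    (∀ a b → sieve s (𝟙 (A? a b)) (λ i → 𝟙 (B₁? i a b)) (λ i → 𝟙 (B₂? i a b)) (λ i → 𝟙 (B₃? i a b))
               ℤ.≤ + 𝟙 (Q? a b)) →
    sieve s (countPairs A A?) (λ i → countPairs (B₁ i) (B₁? i)) (λ i → countPairs (B₂ i) (B₂? i))
            (λ i → countPairs (B₃ i) (B₃? i)) ℤ.≤ + countPairs Q Q?
  sieve-countPairs s Q? A? B₁? B₂? B₃? pointwise =
    sieve-sum s (allFin q) λ x → sieve-sum s (allFin q) λ y → pointwise (to x) (to y)
    where open Inverse enum using (to)

  N-sieve : ∀ u v {m k e s} (p : Fin s → ℕ) → .{{_ : NonZero m}} → .{{nzk : NonZero k}} → .{{_ : NonZero e}} →
    (nzpk : ∀ i → NonZero (p i ℕ.* k)) → Rad m ≡ k ℕ.* ∏ℕ s p →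
    sieve s (N u v k k k e) (λ i → N u v (p i ℕ.* k) k k e {{nzpk i}}) (λ i → N u v k (p i ℕ.* k) k e {{nzk}} {{nzpk i}})
            (λ i → N u v k k (p i ℕ.* k) e {{nzk}} {{nzk}} {{nzpk i}}) ℤ.≤ + N u v m m m e
  N-sieve u v {m} {k} {e} {s} p {{_}} {{nzk}} nzpk rad =
    sieve-countPairs s (cond? m m m e) (cond? k k k e) cond₁? cond₂? cond₃? λ a b →
      sieve-indicator s (cond? m m m e a b) (cond? k k k e a b) (λ i → cond₁? i a b) (λ i → cond₂? i a b) (λ i → cond₃? i a b)
        (λ i → [ cond-∣ (k∣pk i) ∣-refl ∣-refl ∣-refl
               , [ cond-∣ ∣-refl (k∣pk i) ∣-refl ∣-refl
                 , cond-∣ ∣-refl ∣-refl (k∣pk i) ∣-refl ] ])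
        (cond[k]∧cond[pk]⇒cond[m] p rad)
    where
    -- The decision procedure used inside N, so that countPairs (Cond u v …) (cond? …) is N u v ….
    cond? : (e₁ e₂ e₃ e₄ : ℕ) → .{{NonZero e₁}} → .{{NonZero e₂}} → .{{NonZero e₃}} → .{{NonZero e₄}} →
      ∀ a b → Dec (Cond u v e₁ e₂ e₃ e₄ a b)
    cond? e₁ e₂ e₃ e₄ a b = ¬? (a ≟ 0#) ×-dec ¬? (b ≟ 0#) ×-dec free? e₁ a ×-dec free? e₂ b ×-dec
      free? e₃ (u * a + v * b) ×-dec free? e₄ (v * a ⁻¹ + u * b ⁻¹)
    pk : Fin s → ℕ
    pk i = p i ℕ.* k
    k∣pk : ∀ i → k ∣ pk i
    k∣pk i = n∣m*n (p i)
    cond₁? : ∀ i a b → Dec (Cond u v (pk i) k k e a b)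
    cond₂? : ∀ i a b → Dec (Cond u v k (pk i) k e a b)
    cond₃? : ∀ i a b → Dec (Cond u v k k (pk i) e a b)
    cond₁? i = cond? (pk i) k k e {{nzpk i}}
    cond₂? i = cond? k (pk i) k e {{nzk}} {{nzpk i}}
    cond₃? i = cond? k k (pk i) e {{nzk}} {{nzk}} {{nzpk i}}

ι : ℤ → ℚ
ι z = z ℚ./ 1

ιᵘ : ∀ a → toℚᵘ (ι a) ℚᵘ.≃ mkℚᵘ a 0
ιᵘ a = toℚᵘ-fromℚᵘ (mkℚᵘ a 0)

ι-+ : ∀ a b → ι (a ℤ.+ b) ≡ ι a ℚ.+ ι b
ι-+ a b = toℚᵘ-injective (begin
  toℚᵘ (ι (a ℤ.+ b))          ≈⟨ ιᵘ (a ℤ.+ b) ⟩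
  mkℚᵘ (a ℤ.+ b) 0            ≈⟨ *≡* (cross-multiplied a b) ⟩
  mkℚᵘ a 0 ℚᵘ.+ mkℚᵘ b 0      ≈⟨ ℚᵘP.+-cong (ιᵘ a) (ιᵘ b) ⟨
  toℚᵘ (ι a) ℚᵘ.+ toℚᵘ (ι b)  ≈⟨ toℚᵘ-homo-+ (ι a) (ι b) ⟨
  toℚᵘ (ι a ℚ.+ ι b)          ∎)
  where
  open ℚᵘP.≃-Reasoning
  cross-multiplied : ∀ x y → (x ℤ.+ y) ℤ.* + 1 ≡ (x ℤ.* + 1 ℤ.+ y ℤ.* + 1) ℤ.* + 1
  cross-multiplied = solve-∀

ι-* : ∀ a b → ι (a ℤ.* b) ≡ ι a ℚ.* ι b
ι-* a b = toℚᵘ-injective (begin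
  toℚᵘ (ι (a ℤ.* b))          ≈⟨ ιᵘ (a ℤ.* b) ⟩
  mkℚᵘ (a ℤ.* b) 0            ≈⟨ ℚᵘP.≃-refl ⟩
  mkℚᵘ a 0 ℚᵘ.* mkℚᵘ b 0      ≈⟨ ℚᵘP.*-cong (ιᵘ a) (ιᵘ b) ⟨
  toℚᵘ (ι a) ℚᵘ.* toℚᵘ (ι b)  ≈⟨ toℚᵘ-homo-* (ι a) (ι b) ⟨
  toℚᵘ (ι a ℚ.* ι b)          ∎)
  where open ℚᵘP.≃-Reasoning

ι-neg : ∀ a → ι (ℤ.- a) ≡ ℚ.- ι a
ι-neg a = toℚᵘ-injective (begin
  toℚᵘ (ι (ℤ.- a))            ≈⟨ ιᵘ (ℤ.- a) ⟩
  mkℚᵘ (ℤ.- a) 0              ≈⟨ ℚᵘP.≃-refl ⟩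
  ℚᵘ.- mkℚᵘ a 0               ≈⟨ ℚᵘP.-‿cong (ιᵘ a) ⟨
  ℚᵘ.- toℚᵘ (ι a)             ≈⟨ toℚᵘ-homo‿- (ι a) ⟨
  toℚᵘ (ℚ.- ι a)              ∎)
  where open ℚᵘP.≃-Reasoning

ι-mono-≤ : ∀ {a b} → a ℤ.≤ b → ι a ℚ.≤ ι b
ι-mono-≤ {a} {b} a≤b = toℚᵘ-cancel-≤ (begin
  toℚᵘ (ι a)  ≃⟨ ιᵘ a ⟩
  mkℚᵘ a 0    ≤⟨ *≤* (ℤP.*-monoʳ-≤-nonNeg (+ 1) a≤b) ⟩
  mkℚᵘ b 0    ≃⟨ ιᵘ b ⟨
  toℚᵘ (ι b)  ∎)
  where open ℚᵘP.≤-Reasoning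

∑ℚ-cong : ∀ s {f g : Fin s → ℚ} → (∀ i → f i ≡ g i) → ∑ℚ s f ≡ ∑ℚ s g
∑ℚ-cong zero    f≗g = refl
∑ℚ-cong (suc s) f≗g = cong₂ ℚ._+_ (f≗g Fin.zero) (∑ℚ-cong s (λ i → f≗g (Fin.suc i)))

∑ℚ-+ : ∀ s (f g : Fin s → ℚ) → ∑ℚ s (λ i → f i ℚ.+ g i) ≡ ∑ℚ s f ℚ.+ ∑ℚ s g
∑ℚ-+ zero    f g = sym (ℚP.+-identityʳ ℚ.0ℚ)
∑ℚ-+ (suc s) f g = trans (cong (λ x → (f Fin.zero ℚ.+ g Fin.zero) ℚ.+ x) (∑ℚ-+ s _ _))
  (+-interchange (f Fin.zero) (g Fin.zero) _ _)
  where open import Algebra.Properties.CommutativeSemigroup (CommutativeMonoid.commutativeSemigroup ℚP.+-0-commutativeMonoid)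
          using () renaming (interchange to +-interchange)

∑ℚ-*ˡ : ∀ s c (f : Fin s → ℚ) → ∑ℚ s (λ i → c ℚ.* f i) ≡ c ℚ.* ∑ℚ s f
∑ℚ-*ˡ zero    c f = sym (ℚP.*-zeroʳ c)
∑ℚ-*ˡ (suc s) c f = trans (cong (λ x → c ℚ.* f Fin.zero ℚ.+ x) (∑ℚ-*ˡ s c _))
  (sym (ℚP.*-distribˡ-+ c (f Fin.zero) _))

∑ℚ-const : ∀ s c → ∑ℚ s (λ _ → c) ≡ ι (+ s) ℚ.* c
∑ℚ-const zero    c = sym (ℚP.*-zeroˡ c)
∑ℚ-const (suc s) c = begin
  c ℚ.+ ∑ℚ s (λ _ → c)          ≡⟨ cong (λ x → c ℚ.+ x) (∑ℚ-const s c) ⟩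
  c ℚ.+ ι (+ s) ℚ.* c           ≡⟨ cong (λ x → x ℚ.+ ι (+ s) ℚ.* c) (ℚP.*-identityˡ c) ⟨
  ℚ.1ℚ ℚ.* c ℚ.+ ι (+ s) ℚ.* c  ≡⟨ ℚP.*-distribʳ-+ c ℚ.1ℚ (ι (+ s)) ⟨
  (ℚ.1ℚ ℚ.+ ι (+ s)) ℚ.* c      ≡⟨ cong (ℚ._* c) (ι-+ (+ 1) (+ s)) ⟨
  ι (+ suc s) ℚ.* c             ∎
  where open ≡-Reasoning

ι-∑ : ∀ s (f : Fin s → ℤ) → ι (∑ℤ s f) ≡ ∑ℚ s (ι ∘ f)
ι-∑ zero    f = refl
ι-∑ (suc s) f = trans (ι-+ (f Fin.zero) _) (cong (λ x → ι (f Fin.zero) ℚ.+ x) (ι-∑ s (λ i → f (Fin.suc i))))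

φ-prime : ∀ n → Prime (suc n) → φ (suc n) ≡ n
φ-prime n pr = begin
  length (filter C (map suc (upTo (suc n))))                  ≡⟨ cong (λ l → length (filter C (map suc l))) (upTo-∷ʳ n) ⟨
  length (filter C (map suc (upTo n ++ n ∷ [])))              ≡⟨ cong (length ∘ filter C) (map-++ suc (upTo n) (n ∷ [])) ⟩
  length (filter C (map suc (upTo n) ++ suc n ∷ []))          ≡⟨ cong length (filter-++ C (map suc (upTo n)) (suc n ∷ [])) ⟩
  length (filter C (map suc (upTo n)) ++ filter C (suc n ∷ [])) ≡⟨ cong₂ (λ x y → length (x ++ y)) (filter-all C below-coprime) (filter-reject C self-not-coprime) ⟩
  length (map suc (upTo n) ++ [])                             ≡⟨ cong length (++-identityʳ (map suc (upTo n))) ⟩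
  length (map suc (upTo n))                                   ≡⟨ length-map suc (upTo n) ⟩
  length (upTo n)                                             ≡⟨ length-upTo n ⟩
  n                                                           ∎
  where
  open ≡-Reasoning
  C = λ i → coprime? i (suc n)
  below-coprime : All (λ i → Coprime i (suc n)) (map suc (upTo n))
  below-coprime = map⁺ (applyUpTo⁺₁ (λ i → i) n (λ i<n → C.sym (prime⇒coprime pr (s≤s i<n))))
  self-not-coprime : ¬ Coprime (suc n) (suc n)
  self-not-coprime coprime = prime≢1 pr (coprime (∣-refl , ∣-refl))

θ-prime : ∀ p (pr : Prime p) → θ p {{prime⇒nonZero pr}} ≡ ℚ.1ℚ ℚ.- (+ 1 ℚ./ p) {{prime⇒nonZero pr}}
θ-prime (suc n) pr rewrite φ-prime n pr = toℚᵘ-injective (begin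
  toℚᵘ (+ n ℚ./ suc n)                                ≈⟨ toℚᵘ-fromℚᵘ (mkℚᵘ (+ n) n) ⟩
  mkℚᵘ (+ n) n                                        ≈⟨ *≡* (cross-multiplied (+ n)) ⟩
  mkℚᵘ (+ 1) 0 ℚᵘ.- mkℚᵘ (+ 1) n                      ≈⟨ ℚᵘP.+-cong (ιᵘ (+ 1)) (ℚᵘP.-‿cong (toℚᵘ-fromℚᵘ (mkℚᵘ (+ 1) n))) ⟨
  toℚᵘ ℚ.1ℚ ℚᵘ.- toℚᵘ (+ 1 ℚ./ suc n)                  ≈⟨ ℚᵘP.+-congʳ (toℚᵘ ℚ.1ℚ) (toℚᵘ-homo‿- (+ 1 ℚ./ suc n)) ⟨
  toℚᵘ ℚ.1ℚ ℚᵘ.+ toℚᵘ (ℚ.- (+ 1 ℚ./ suc n))            ≈⟨ toℚᵘ-homo-+ ℚ.1ℚ (ℚ.- (+ 1 ℚ./ suc n)) ⟨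
  toℚᵘ (ℚ.1ℚ ℚ.- (+ 1 ℚ./ suc n))                      ∎)
  where
  open ℚᵘP.≃-Reasoning
  cross-multiplied : ∀ x → x ℤ.* (+ 1 ℤ.* (+ 1 ℤ.+ x)) ≡ (+ 1 ℤ.* (+ 1 ℤ.+ x) ℤ.+ ℤ.- + 1 ℤ.* + 1) ℤ.* (+ 1 ℤ.+ x)
  cross-multiplied = solve-∀

module _ (s : ℕ) (a : ℕ) (b₁ b₂ b₃ : Fin s → ℕ) where

  private
    X = ι (+ a)
    W = + 3 ℚ./ 1
    T : Fin s → ℚ
    T i = ι (+ b₁ i) ℚ.+ ι (+ b₂ i) ℚ.+ ι (+ b₃ i)

  ι-sieve : ι (sieve s a b₁ b₂ b₃) ≡ ∑ℚ s T ℚ.- (W ℚ.* ι (+ s) ℚ.- ℚ.1ℚ) ℚ.* X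
  ι-sieve = begin
    ι (∑ℤ s t ℤ.+ ℤ.- (c ℤ.* + a))          ≡⟨ ι-+ (∑ℤ s t) (ℤ.- (c ℤ.* + a)) ⟩
    ι (∑ℤ s t) ℚ.+ ι (ℤ.- (c ℤ.* + a))      ≡⟨ cong₂ ℚ._+_ (ι-∑ s t) (trans (ι-neg (c ℤ.* + a)) (cong ℚ.-_ (ι-* c (+ a)))) ⟩
    ∑ℚ s (ι ∘ t) ℚ.- ι c ℚ.* X              ≡⟨ cong₂ (λ x y → x ℚ.- y ℚ.* X) (∑ℚ-cong s ι∘t≡T) ι[c] ⟩
    ∑ℚ s T ℚ.- (W ℚ.* ι (+ s) ℚ.- ℚ.1ℚ) ℚ.* X ∎
    where
    open ≡-Reasoning
    c = + (3 ℕ.* s) ℤ.- + 1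
    t : Fin s → ℤ
    t i = + b₁ i ℤ.+ + b₂ i ℤ.+ + b₃ i
    ι∘t≡T : ∀ i → ι (t i) ≡ T i
    ι∘t≡T i = trans (ι-+ (+ b₁ i ℤ.+ + b₂ i) (+ b₃ i)) (cong (ℚ._+ ι (+ b₃ i)) (ι-+ (+ b₁ i) (+ b₂ i)))
    ι[c] : ι c ≡ W ℚ.* ι (+ s) ℚ.- ℚ.1ℚ
    ι[c] = trans (ι-+ (+ (3 ℕ.* s)) (ℤ.- + 1)) (cong (ℚ._- ℚ.1ℚ) (trans (cong ι (ℤP.pos-* 3 s)) (ι-* (+ 3) (+ s))))

  weighted-sieve≡ : (r θ′ : Fin s → ℚ) → (∀ i → θ′ i ≡ ℚ.1ℚ ℚ.- r i) →
    ∑ℚ s (λ i → (ι (+ b₁ i) ℚ.- θ′ i ℚ.* X) ℚ.+ (ι (+ b₂ i) ℚ.- θ′ i ℚ.* X) ℚ.+ (ι (+ b₃ i) ℚ.- θ′ i ℚ.* X))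
      ℚ.+ (ℚ.1ℚ ℚ.- W ℚ.* ∑ℚ s r) ℚ.* X
    ≡ ∑ℚ s T ℚ.- (W ℚ.* ι (+ s) ℚ.- ℚ.1ℚ) ℚ.* X
  weighted-sieve≡ r θ′ θ′≡1-r = begin
    ∑ℚ s (λ i → (ι (+ b₁ i) ℚ.- θ′ i ℚ.* X) ℚ.+ (ι (+ b₂ i) ℚ.- θ′ i ℚ.* X) ℚ.+ (ι (+ b₃ i) ℚ.- θ′ i ℚ.* X))
      ℚ.+ (ℚ.1ℚ ℚ.- W ℚ.* R) ℚ.* X
        ≡⟨ cong (ℚ._+ (ℚ.1ℚ ℚ.- W ℚ.* R) ℚ.* X) (∑ℚ-cong s summand≡) ⟩
    ∑ℚ s (λ i → (T i ℚ.+ ℚ.- (W ℚ.* X)) ℚ.+ (W ℚ.* X) ℚ.* r i) ℚ.+ (ℚ.1ℚ ℚ.- W ℚ.* R) ℚ.* X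
        ≡⟨ cong (ℚ._+ (ℚ.1ℚ ℚ.- W ℚ.* R) ℚ.* X) ∑-split ⟩
    (∑ℚ s T ℚ.+ ι (+ s) ℚ.* ℚ.- (W ℚ.* X) ℚ.+ (W ℚ.* X) ℚ.* R) ℚ.+ (ℚ.1ℚ ℚ.- W ℚ.* R) ℚ.* X
        ≡⟨ collect (∑ℚ s T) (ι (+ s)) W X R ⟩
    ∑ℚ s T ℚ.- (W ℚ.* ι (+ s) ℚ.- ℚ.1ℚ) ℚ.* X ∎
    where
    open ≡-Reasoning
    open +-*-Solver
    R = ∑ℚ s r
    summand≡ : ∀ i → (ι (+ b₁ i) ℚ.- θ′ i ℚ.* X) ℚ.+ (ι (+ b₂ i) ℚ.- θ′ i ℚ.* X) ℚ.+ (ι (+ b₃ i) ℚ.- θ′ i ℚ.* X)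
                   ≡ (T i ℚ.+ ℚ.- (W ℚ.* X)) ℚ.+ (W ℚ.* X) ℚ.* r i
    -- W = + 3 / 1 normalises to 1ℚ + 1ℚ + 1ℚ, which is how it is handed to the solver.
    summand≡ i rewrite θ′≡1-r i =
      solve 5 (λ x y z ρ ξ → (x :- (con ℚ.1ℚ :- ρ) :* ξ) :+ (y :- (con ℚ.1ℚ :- ρ) :* ξ) :+ (z :- (con ℚ.1ℚ :- ρ) :* ξ)
                          := (x :+ y :+ z :+ :- (three :* ξ)) :+ (three :* ξ) :* ρ)
        refl (ι (+ b₁ i)) (ι (+ b₂ i)) (ι (+ b₃ i)) (r i) X
      where three = con ℚ.1ℚ :+ con ℚ.1ℚ :+ con ℚ.1ℚ
    ∑-split : ∑ℚ s (λ i → (T i ℚ.+ ℚ.- (W ℚ.* X)) ℚ.+ (W ℚ.* X) ℚ.* r i)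
              ≡ ∑ℚ s T ℚ.+ ι (+ s) ℚ.* ℚ.- (W ℚ.* X) ℚ.+ (W ℚ.* X) ℚ.* R
    ∑-split = begin
      ∑ℚ s (λ i → (T i ℚ.+ ℚ.- (W ℚ.* X)) ℚ.+ (W ℚ.* X) ℚ.* r i)   ≡⟨ ∑ℚ-+ s _ _ ⟩
      ∑ℚ s (λ i → T i ℚ.+ ℚ.- (W ℚ.* X)) ℚ.+ ∑ℚ s (λ i → (W ℚ.* X) ℚ.* r i)
        ≡⟨ cong₂ ℚ._+_ (trans (∑ℚ-+ s T _) (cong (∑ℚ s T ℚ.+_) (∑ℚ-const s _))) (∑ℚ-*ˡ s (W ℚ.* X) r) ⟩
      ∑ℚ s T ℚ.+ ι (+ s) ℚ.* ℚ.- (W ℚ.* X) ℚ.+ (W ℚ.* X) ℚ.* R      ∎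
    collect : ∀ τ σ w ξ ρ → (τ ℚ.+ σ ℚ.* ℚ.- (w ℚ.* ξ) ℚ.+ (w ℚ.* ξ) ℚ.* ρ) ℚ.+ (ℚ.1ℚ ℚ.- w ℚ.* ρ) ℚ.* ξ
                           ≡ τ ℚ.- (w ℚ.* σ ℚ.- ℚ.1ℚ) ℚ.* ξ
    collect = solve 5 (λ τ σ w ξ ρ → (τ :+ σ :* :- (w :* ξ) :+ (w :* ξ) :* ρ) :+ (con ℚ.1ℚ :- w :* ρ) :* ξ
                                   := τ :- (w :* σ :- con ℚ.1ℚ) :* ξ) refl

  sieve-weighted : ∀ Nq (r θ′ : Fin s → ℚ) → (∀ i → θ′ i ≡ ℚ.1ℚ ℚ.- r i) → sieve s a b₁ b₂ b₃ ℤ.≤ + Nq →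
    ∑ℚ s (λ i → (ι (+ b₁ i) ℚ.- θ′ i ℚ.* X) ℚ.+ (ι (+ b₂ i) ℚ.- θ′ i ℚ.* X) ℚ.+ (ι (+ b₃ i) ℚ.- θ′ i ℚ.* X))
      ℚ.+ (ℚ.1ℚ ℚ.- W ℚ.* ∑ℚ s r) ℚ.* X ℚ.≤ ι (+ Nq)
  sieve-weighted Nq r θ′ θ′≡1-r sieve≤Nq =
    ℚP.≤-trans (ℚP.≤-reflexive (trans (weighted-sieve≡ r θ′ θ′≡1-r) (sym ι-sieve))) (ι-mono-≤ sieve≤Nq)

lemma5p2 : (q : ℕ) → IsPrimePower q → (F : FiniteField q) →
  let open FiniteField F in
  (u v : Carrier) → u ≢ 0# → v ≢ 0# →
  (k s : ℕ) (p : Fin s → ℕ) (pr : ∀ i → Prime (p i)) → (∀ i j → p i ≡ p j → i ≡ j) →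
  (rad : Rad (q ∸ 1) ≡ k ℕ.* ∏ℕ s p) →
  let nzk : NonZero k
      nzk = k≢0 {q ∸ 1} {k} {∏ℕ s p} rad
      nzq : NonZero (q ∸ 1)
      nzq = q-1≢0 F
      nzpk : ∀ i → NonZero (p i ℕ.* k)
      nzpk i = m*n≢0 (p i) k {{prime⇒nonZero (pr i)}} {{nzk}}
      Nq : ℕ
      Nq = N u v (q ∸ 1) (q ∸ 1) (q ∸ 1) (q ∸ 1) {{nzq}} {{nzq}} {{nzq}} {{nzq}}
      Nk : ℕ
      Nk = N u v k k k (q ∸ 1) {{nzk}} {{nzk}} {{nzk}} {{nzq}}
      N₁ : Fin s → ℕ
      N₁ i = N u v (p i ℕ.* k) k k (q ∸ 1) {{nzpk i}} {{nzk}} {{nzk}} {{nzq}}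
      N₂ : Fin s → ℕ
      N₂ i = N u v k (p i ℕ.* k) k (q ∸ 1) {{nzk}} {{nzpk i}} {{nzk}} {{nzq}}
      N₃ : Fin s → ℕ
      N₃ i = N u v k k (p i ℕ.* k) (q ∸ 1) {{nzk}} {{nzk}} {{nzpk i}} {{nzq}}
      toℚ : ℕ → ℚ
      toℚ n = (+ n) ℚ./ 1
      θp : Fin s → ℚ
      θp i = θ (p i) {{prime⇒nonZero (pr i)}}
      δ₃ : ℚ
      δ₃ = ℚ.1ℚ ℚ.- (+ 3 ℚ./ 1) ℚ.* ∑ℚ s (λ i → (+ 1 ℚ./ p i) {{prime⇒nonZero (pr i)}})
  in (+ Nq ℤ.≥ ∑ℤ s (λ i → + N₁ i ℤ.+ + N₂ i ℤ.+ + N₃ i) ℤ.- (+ (3 ℕ.* s) ℤ.- + 1) ℤ.* + Nk)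
   × (toℚ Nq ℚ.≥ ∑ℚ s (λ i → (toℚ (N₁ i) ℚ.- θp i ℚ.* toℚ Nk)
                             ℚ.+ (toℚ (N₂ i) ℚ.- θp i ℚ.* toℚ Nk)
                             ℚ.+ (toℚ (N₃ i) ℚ.- θp i ℚ.* toℚ Nk))
                 ℚ.+ δ₃ ℚ.* toℚ Nk)
lemma5p2 q _ F u v _ _ k s p pr _ rad = bound , sieve-weighted s Nk N₁ N₂ N₃ Nq r θp θp≡1-r bound
  where
  open FiniteField F using (N)
  instance
    nzq : NonZero (q ∸ 1)
    nzq = q-1≢0 F
    nzk : NonZero k
    nzk = k≢0 {q ∸ 1} {k} {∏ℕ s p} rad
  nzp : ∀ i → NonZero (p i)
  nzp i = prime⇒nonZero (pr i)
  nzpk : ∀ i → NonZero (p i ℕ.* k)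
  nzpk i = m*n≢0 (p i) k {{nzp i}}
  Nq Nk : ℕ
  Nq = N u v (q ∸ 1) (q ∸ 1) (q ∸ 1) (q ∸ 1)
  Nk = N u v k k k (q ∸ 1)
  N₁ N₂ N₃ : Fin s → ℕ
  N₁ i = N u v (p i ℕ.* k) k k (q ∸ 1) {{nzpk i}}
  N₂ i = N u v k (p i ℕ.* k) k (q ∸ 1) {{nzk}} {{nzpk i}}
  N₃ i = N u v k k (p i ℕ.* k) (q ∸ 1) {{nzk}} {{nzk}} {{nzpk i}}
  bound : sieve s Nk N₁ N₂ N₃ ℤ.≤ + Nq
  bound = N-sieve F u v {q ∸ 1} {k} {q ∸ 1} p nzpk rad
  r θp : Fin s → ℚ
  r i = (+ 1 ℚ./ p i) {{nzp i}}
  θp i = θ (p i) {{nzp i}}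
  θp≡1-r : ∀ i → θp i ≡ ℚ.1ℚ ℚ.- r i
  θp≡1-r i = θ-prime (p i) (pr i)
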